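{- Let $\Sigma=(\Gamma,sgn)$ be a simple signed graph with edge set $E=\{e_1,\dots,e_m\}$, and let $G=(\Sigma,\tau)$ be an oriented signed graph, regarded as a simple 2-uniform oriented hypergraph. Then $A_{(\Lambda(\Gamma),\tau_\Lambda)}=A_{G^*}$, where both matrices are $m\times m$ with rows and columns indexed by $e_1,\dots,e_m$.
   Context: A signed graph $\Sigma=(\Gamma,sgn)$ is a graph $\Gamma=(V,E)$ with a signature $sgn:E\to\{+1,-1\}$; simple means no loops or multiple edges. An orientation is $\tau:V\times E\to\{ -1,0,+1\}$ with $\tau(v,e)\neq 0$ iff $v$ is incident to $e$, and $\tau(v,e)\tau(w,e)=-sgn(e)$ when $e$ joins $v$ and $w$; $(\Sigma,\tau)$ is an oriented signed graph. It is regarded as the oriented hypergraph with vertex set $V$, edge set $E$, incidences $(v,e)$ for $v$ an endpoint of $e$, and incidence orientation $\sigma(v,e)=\tau(v,e)$. For a simple oriented hypergraph $H$ (each vertex-edge pair incident at most once), vertices $v\ne w$ are adjacent with respect to edge $e$ if both are incident to $e$, with adjacency sign $sgn_e(v,w)=-\sigma(v,e)\sigma(w,e)$ ($0$ if not adjacent, and $sgn_e(v,v)=0$); the adjacency matrix is $A_H=[a_{ij}]$ with $a_{ij}=\sum_{e}sgn_e(v_i,v_j)$. The incidence dual $G^*$ has vertex set $E$, edge set $V$, incidences $(e,v)$ for each incidence $(v,e)$ of $G$, and orientation $\sigma^*(e,v)=\sigma(v,e)$. The line graph $\Lambda(\Gamma)$ has vertex set $E$, with an edge $e_{ij}e_{jk}$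 joining any two edges $e_{ij},e_{jk}$ of $\Gamma$ sharing a vertex $v_j$. Its orientation is $\tau_\Lambda(e_{ij},e_{ij}e_{jk})=\tau(v_j,e_{ij})$, making $(\Lambda(\Gamma),\tau_\Lambda)$ an oriented signed graph whose edge signs are $sgn_{\Lambda(\tau)}(e_{ij}e_{jk})=-\tau_\Lambda(e_{ij},e_{ij}e_{jk})\tau_\Lambda(e_{jk},e_{ij}e_{jk})$; its adjacency matrix is that of the corresponding oriented hypergraph. -}

module Defs where

open import Data.Nat using (ℕ; _<ᵇ_)
open import Data.Fin using (Fin; toℕ; _≟_)
open import Data.Fin.Properties using ()
open import Data.Integer using (ℤ; _+_; _*_; -_; 0ℤ; 1ℤ; -1ℤ)
open import Data.Bool using (Bool; true; false; _∧_; _∨_; not; if_then_else_; T)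
open import Data.List using (List; foldr; map; filterᵇ; cartesianProduct; allFin)
open import Data.Product using (_×_; _,_; proj₁; proj₂)
open import Data.Sum using (_⊎_)
open import Relation.Nullary using (¬_)
open import Relation.Nullary.Decidable using (⌊_⌋)
open import Relation.Binary.PropositionalEquality using (_≡_; _≢_)

sumℤ : List ℤ → ℤ
sumℤ = foldr _+_ 0ℤ

_==ᶠ_ : ∀ {n} → Fin n → Fin n → Bool
i ==ᶠ j = ⌊ i ≟ j ⌋

-- Simple (vertex-edge incidence at most once) oriented hypergraphs.
-- Vertex set Fin nV; edge set = the elements of the list `edges`
-- (of some label type E); `inc v e` says v is incident to e, and
-- σ v e is the incidence orientation (only meaningful when incident).

record OHG : Set₁ where
  field
    nV    : ℕ
    E     : Set
    edges : List E
    inc   : Fin nV → E → Bool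
    σ     : Fin nV → E → ℤ

open OHG public

adjSign : (H : OHG) → E H → Fin (nV H) → Fin (nV H) → ℤ
adjSign H e v w =
  if not (v ==ᶠ w) ∧ inc H v e ∧ inc H w e
  then - (σ H v e * σ H w e)
  else 0ℤ

adjMatrix : (H : OHG) → Fin (nV H) → Fin (nV H) → ℤ
adjMatrix H i j = sumℤ (map (λ e → adjSign H e i j) (edges H))

dualFin : (m : ℕ) (n : ℕ) → (Fin n → Fin m → Bool) → (Fin n → Fin m → ℤ) → OHG
dualFin m n inc′ σ′ = record
  { nV = m ; E = Fin n ; edges = allFin n
  ; inc = λ e v → inc′ v e ; σ = λ e v → σ′ v e }

record SimpleSignedGraph (n m : ℕ) : Set where
  field
    ends   : Fin m → Fin n × Fin n
    noLoop : ∀ e → proj₁ (ends e) ≢ proj₂ (ends e)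
    noMulti : ∀ e f →
      ((proj₁ (ends e) ≡ proj₁ (ends f) × proj₂ (ends e) ≡ proj₂ (ends f)) ⊎
       (proj₁ (ends e) ≡ proj₂ (ends f) × proj₂ (ends e) ≡ proj₁ (ends f))) → e ≡ f
    sgn    : Fin m → ℤ
    sgn±1  : ∀ e → sgn e ≡ 1ℤ ⊎ sgn e ≡ -1ℤ

open SimpleSignedGraph public

module _ {n m : ℕ} (Σ : SimpleSignedGraph n m) where

  incidentᵇ : Fin n → Fin m → Bool
  incidentᵇ v e = (v ==ᶠ proj₁ (ends Σ e)) ∨ (v ==ᶠ proj₂ (ends Σ e))

  record Orientation : Set where
    field
      τ        : Fin n → Fin m → ℤ
      τ-range  : ∀ v e → τ v e ≡ 1ℤ ⊎ τ v e ≡ 0ℤ ⊎ τ v e ≡ -1ℤ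
      τ-nonzero : ∀ v e → (τ v e ≢ 0ℤ → T (incidentᵇ v e)) × (T (incidentᵇ v e) → τ v e ≢ 0ℤ)
      τ-sign   : ∀ e → τ (proj₁ (ends Σ e)) e * τ (proj₂ (ends Σ e)) e ≡ - sgn Σ e

  open Orientation public

  asOHG : Orientation → OHG
  asOHG o = record
    { nV = n ; E = Fin m ; edges = allFin m ; inc = incidentᵇ ; σ = τ o }

  dualOHG : Orientation → OHG
  dualOHG o = dualFin m n incidentᵇ (τ o)

  -- line graph Λ(Γ): vertex set E; an edge e_ij e_jk for each pair of
  -- distinct edges (e,f), taken once (toℕ e < toℕ f), sharing a vertex v_j.
  -- Edges are labelled by triples (e , f , v_j).
  lineEdges : List (Fin m × Fin m × Fin n)
  lineEdges = filterᵇ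
    (λ { (e , f , v) → (toℕ e <ᵇ toℕ f) ∧ incidentᵇ v e ∧ incidentᵇ v f })
    (cartesianProduct (allFin m) (cartesianProduct (allFin m) (allFin n)))

  lineOHG : Orientation → OHG
  lineOHG o = record
    { nV = m ; E = Fin m × Fin m × Fin n ; edges = lineEdges
    ; inc = λ { x (e , f , v) → (x ==ᶠ e) ∨ (x ==ᶠ f) }
    ; σ = λ { x (e , f , v) → τ o v x } }

-- On the diagonal every
-- adjacency sign vanishes (adjacency needs v ≠ w), so both sides are 0.
-- Off the diagonal, for edges i ≠ j of Γ:
--   * the G*-entry is  Σ_v [v ∈ i ∧ v ∈ j] · w v  with  w v = -τ(v,i)τ(v,j);
--   * the Λ-entry is a sum over triples (e, f, v) with e < f sharing v,
--     and the triple contributes only when {e, f} = {i, j}, contributing w v.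
-- Rewriting the filtered triple sum as an iterated sum Σ_e Σ_f Σ_v, the
-- outer double sum is supported on the two points (i, j) and (j, i); the
-- ordering condition e < f selects exactly one of them, which yields the
-- G*-entry.
module Submission where

open import Defs
open import Data.Nat using (ℕ; _<_; _<ᵇ_)
open import Data.Nat.Properties using (<ᵇ⇒<; <⇒<ᵇ; <-cmp; <-asym)
open import Data.Fin using (Fin; zero; suc; toℕ; _≟_)
open import Data.Fin.Properties using (toℕ-injective)
open import Data.Integer using (ℤ; _+_; -_; _*_; 0ℤ)
open import Data.Integer.Properties using (+-identityˡ; +-identityʳ; +-assoc; +-commutativeSemigroup)
open import Algebra.Properties.CommutativeSemigroup +-commutativeSemigroup using (interchange)
open import Data.Bool using (Bool; true; false; _∧_; _∨_; not; if_then_else_; T)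
open import Data.Bool.Properties using (T-≡; T-∧; T-∨; ¬-not; ∧-zeroʳ; if-eta)
open import Data.List using (List; []; _∷_; _++_; map; filterᵇ; cartesianProduct; allFin)
open import Data.List.Properties using (map-cong; map-∘; map-tabulate)
open import Data.Product using (_×_; _,_)
open import Data.Sum using (_⊎_; inj₁; inj₂)
open import Function using (_∘_; id)
open import Function.Bundles using (Equivalence)
open import Relation.Nullary using (¬_; Dec; yes; no; contradiction)
open import Relation.Nullary.Decidable using (isYes≗does; dec-true; dec-false; toWitness)
open import Relation.Binary using (tri<; tri≈; tri>)
open import Relation.Binary.PropositionalEquality
  using (_≡_; _≢_; refl; sym; trans; cong; cong₂; subst; module ≡-Reasoning)

open Equivalence using (to; from)

sumOver : {A : Set} → List A → (A → ℤ) → ℤ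
sumOver xs h = sumℤ (map h xs)

sumOver-cong : {A : Set} (xs : List A) {h k : A → ℤ} →
  (∀ x → h x ≡ k x) → sumOver xs h ≡ sumOver xs k
sumOver-cong xs h≗k = cong sumℤ (map-cong h≗k xs)

sumOver-zero : {A : Set} (xs : List A) {h : A → ℤ} →
  (∀ x → h x ≡ 0ℤ) → sumOver xs h ≡ 0ℤ
sumOver-zero []       h≡0 = refl
sumOver-zero (x ∷ xs) h≡0 = cong₂ _+_ (h≡0 x) (sumOver-zero xs h≡0)

sumOver-+ : {A : Set} (xs : List A) (h k : A → ℤ) →
  sumOver xs (λ x → h x + k x) ≡ sumOver xs h + sumOver xs k
sumOver-+ []       h k = refl
sumOver-+ (x ∷ xs) h k = begin
  (h x + k x) + sumOver xs (λ y → h y + k y)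
    ≡⟨ cong ((h x + k x) +_) (sumOver-+ xs h k) ⟩
  (h x + k x) + (sumOver xs h + sumOver xs k)
    ≡⟨ interchange (h x) (k x) (sumOver xs h) (sumOver xs k) ⟩
  (h x + sumOver xs h) + (k x + sumOver xs k) ∎
  where open ≡-Reasoning

sumOver-++ : {A : Set} (xs ys : List A) (h : A → ℤ) →
  sumOver (xs ++ ys) h ≡ sumOver xs h + sumOver ys h
sumOver-++ []       ys h = sym (+-identityˡ _)
sumOver-++ (x ∷ xs) ys h =
  trans (cong (h x +_) (sumOver-++ xs ys h)) (sym (+-assoc (h x) _ _))

sumOver-filter : {A : Set} (p : A → Bool) (h : A → ℤ) (xs : List A) →
  sumOver (filterᵇ p xs) h ≡ sumOver xs (λ x → if p x then h x else 0ℤ)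
sumOver-filter p h []       = refl
sumOver-filter p h (x ∷ xs) with p x
... | true  = cong (h x +_) (sumOver-filter p h xs)
... | false = trans (sumOver-filter p h xs) (sym (+-identityˡ _))

sumOver-cartesian : {A B : Set} (xs : List A) (ys : List B) (h : A × B → ℤ) →
  sumOver (cartesianProduct xs ys) h ≡ sumOver xs (λ x → sumOver ys (λ y → h (x , y)))
sumOver-cartesian []       ys h = refl
sumOver-cartesian (x ∷ xs) ys h =
  trans (sumOver-++ (map (x ,_) ys) _ h)
        (cong₂ _+_ (cong sumℤ (sym (map-∘ ys))) (sumOver-cartesian xs ys h))

sumOver-allFin-suc : (k : ℕ) (h : Fin (ℕ.suc k) → ℤ) →
  sumOver (allFin (ℕ.suc k)) h ≡ h zero + sumOver (allFin k) (h ∘ suc)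
sumOver-allFin-suc k h =
  cong (λ xs → h zero + sumℤ xs) (trans (map-tabulate suc h) (sym (map-tabulate id (h ∘ suc))))

sumOver-support₁ : {k : ℕ} (h : Fin k → ℤ) (a : Fin k) →
  (∀ x → x ≢ a → h x ≡ 0ℤ) → sumOver (allFin k) h ≡ h a
sumOver-support₁ {ℕ.suc k} h zero h≡0 = begin
  sumOver (allFin (ℕ.suc k)) h             ≡⟨ sumOver-allFin-suc k h ⟩
  h zero + sumOver (allFin k) (h ∘ suc)    ≡⟨ cong (h zero +_) (sumOver-zero (allFin k) (λ x → h≡0 (suc x) (λ ()))) ⟩
  h zero + 0ℤ                              ≡⟨ +-identityʳ (h zero) ⟩
  h zero                                   ∎
  where open ≡-Reasoning
sumOver-support₁ {ℕ.suc k} h (suc a) h≡0 = begin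
  sumOver (allFin (ℕ.suc k)) h             ≡⟨ sumOver-allFin-suc k h ⟩
  h zero + sumOver (allFin k) (h ∘ suc)    ≡⟨ cong₂ _+_ (h≡0 zero (λ ())) (sumOver-support₁ (h ∘ suc) a suc-vanishes) ⟩
  0ℤ + h (suc a)                           ≡⟨ +-identityˡ (h (suc a)) ⟩
  h (suc a)                                ∎
  where
  open ≡-Reasoning
  suc-vanishes : ∀ x → x ≢ a → h (suc x) ≡ 0ℤ
  suc-vanishes x x≢a = h≡0 (suc x) (λ { refl → x≢a refl })

==ᶠ-refl : {k : ℕ} (x : Fin k) → x ==ᶠ x ≡ true
==ᶠ-refl x = trans (isYes≗does (x ≟ x)) (dec-true (x ≟ x) refl)

==ᶠ-sound : {k : ℕ} {x y : Fin k} → T (x ==ᶠ y) → x ≡ y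
==ᶠ-sound {x = x} {y} = toWitness {a? = x ≟ y}

==ᶠ-≢ : {k : ℕ} {x y : Fin k} → x ≢ y → x ==ᶠ y ≡ false
==ᶠ-≢ {x = x} {y} x≢y = trans (isYes≗does (x ≟ y)) (dec-false (x ≟ y) x≢y)

-- A function on Fin k vanishing outside two distinct points a, b sums to
-- h a + h b: split h by whether the argument is b and apply the one-point case.
sumOver-support₂ : {k : ℕ} (h : Fin k → ℤ) {a b : Fin k} → a ≢ b →
  (∀ x → x ≢ a → x ≢ b → h x ≡ 0ℤ) → sumOver (allFin k) h ≡ h a + h b
sumOver-support₂ {k} h {a} {b} a≢b h≡0 = begin
  sumOver (allFin k) h                           ≡⟨ sumOver-cong (allFin k) split ⟩
  sumOver (allFin k) (λ x → awayB x + atB x)     ≡⟨ sumOver-+ (allFin k) awayB atB ⟩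
  sumOver (allFin k) awayB + sumOver (allFin k) atB
    ≡⟨ cong₂ _+_ (sumOver-support₁ awayB a awayB-vanishes) (sumOver-support₁ atB b atB-vanishes) ⟩
  awayB a + atB b                                ≡⟨ cong₂ (λ p q → (if p then 0ℤ else h a) + (if q then h b else 0ℤ)) (==ᶠ-≢ a≢b) (==ᶠ-refl b) ⟩
  h a + h b                                      ∎
  where
  open ≡-Reasoning
  awayB atB : Fin k → ℤ
  awayB x = if x ==ᶠ b then 0ℤ else h x
  atB   x = if x ==ᶠ b then h x else 0ℤ

  split : ∀ x → h x ≡ awayB x + atB x
  split x with x ==ᶠ b
  ... | true  = sym (+-identityˡ (h x))
  ... | false = sym (+-identityʳ (h x))

  awayB-vanishes : ∀ x → x ≢ a → awayB x ≡ 0ℤ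
  awayB-vanishes x x≢a with x ≟ b
  ... | yes _   = refl
  ... | no  x≢b = h≡0 x x≢a x≢b

  atB-vanishes : ∀ x → x ≢ b → atB x ≡ 0ℤ
  atB-vanishes x x≢b rewrite ==ᶠ-≢ x≢b = refl

adjMatrix-diagonal : (H : OHG) (v : Fin (nV H)) → adjMatrix H v v ≡ 0ℤ
adjMatrix-diagonal H v = sumOver-zero (edges H) loopless
  where
  loopless : ∀ e → adjSign H e v v ≡ 0ℤ
  loopless e rewrite ==ᶠ-refl v = refl

<ᵇ-true : {m n : ℕ} → m < n → (m <ᵇ n) ≡ true
<ᵇ-true m<n = to T-≡ (<⇒<ᵇ m<n)

<ᵇ-false : {m n : ℕ} → n < m → (m <ᵇ n) ≡ false
<ᵇ-false {m} {n} n<m = ¬-not (λ m<ᵇn → <-asym n<m (<ᵇ⇒< m n (from T-≡ m<ᵇn)))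

<ᵇ-complement : {m n : ℕ} → m ≢ n → (m <ᵇ n) ≡ not (n <ᵇ m)
<ᵇ-complement {m} {n} m≢n with <-cmp m n
... | tri< m<n _ _ = trans (<ᵇ-true m<n) (cong not (sym (<ᵇ-false m<n)))
... | tri≈ _ m≡n _ = contradiction m≡n m≢n
... | tri> _ _ n<m = trans (<ᵇ-false n<m) (cong not (sym (<ᵇ-true n<m)))

guard-by-order : (p a b : Bool) (w : ℤ) →
  (if p ∧ a ∧ b then w else 0ℤ) + (if not p ∧ b ∧ a then w else 0ℤ) ≡ (if a ∧ b then w else 0ℤ)
guard-by-order true  true  true  w = +-identityʳ w
guard-by-order true  true  false w = refl
guard-by-order true  false b     w = refl
guard-by-order false true  true  w = +-identityˡ w
guard-by-order false true  false w = refl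
guard-by-order false false true  w = refl
guard-by-order false false false w = refl

module OffDiagonal {n m : ℕ} (Σ : SimpleSignedGraph n m) (o : Orientation Σ)
                   {i j : Fin m} (i≢j : i ≢ j) where

  w : Fin n → ℤ
  w v = - (τ o v i * τ o v j)

  dual-entry : adjMatrix (dualOHG Σ o) i j ≡
               sumOver (allFin n) (λ v → if incidentᵇ Σ v i ∧ incidentᵇ Σ v j then w v else 0ℤ)
  dual-entry rewrite ==ᶠ-≢ i≢j = refl

  lineTerm : Fin m → Fin m → Fin n → ℤ
  lineTerm e f v =
    if (toℕ e <ᵇ toℕ f) ∧ incidentᵇ Σ v e ∧ incidentᵇ Σ v f
    then adjSign (lineOHG Σ o) (e , f , v) i j else 0ℤ

  line-entry : adjMatrix (lineOHG Σ o) i j ≡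
               sumOver (allFin m) (λ e → sumOver (allFin m) (λ f → sumOver (allFin n) (lineTerm e f)))
  line-entry = begin
    adjMatrix (lineOHG Σ o) i j
      ≡⟨ sumOver-filter _ (λ t → adjSign (lineOHG Σ o) t i j) (cartesianProduct (allFin m) (cartesianProduct (allFin m) (allFin n))) ⟩
    sumOver (cartesianProduct (allFin m) (cartesianProduct (allFin m) (allFin n))) (λ { (e , f , v) → lineTerm e f v })
      ≡⟨ sumOver-cartesian (allFin m) _ _ ⟩
    sumOver (allFin m) (λ e → sumOver (cartesianProduct (allFin m) (allFin n)) (λ { (f , v) → lineTerm e f v }))
      ≡⟨ sumOver-cong (allFin m) (λ e → sumOver-cartesian (allFin m) (allFin n) _) ⟩
    sumOver (allFin m) (λ e → sumOver (allFin m) (λ f → sumOver (allFin n) (lineTerm e f))) ∎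
    where open ≡-Reasoning

  IsPair : Fin m → Fin m → Set
  IsPair e f = (e ≡ i × f ≡ j) ⊎ (e ≡ j × f ≡ i)

  joins-pair : ∀ e f → T ((i ==ᶠ e ∨ i ==ᶠ f) ∧ (j ==ᶠ e ∨ j ==ᶠ f)) → IsPair e f
  joins-pair e f joins
    with to (T-∧ {i ==ᶠ e ∨ i ==ᶠ f} {j ==ᶠ e ∨ j ==ᶠ f}) joins
  ... | i∈ef , j∈ef
    with to (T-∨ {i ==ᶠ e} {i ==ᶠ f}) i∈ef | to (T-∨ {j ==ᶠ e} {j ==ᶠ f}) j∈ef
  ... | inj₁ i≡e | inj₁ j≡e = contradiction (trans (==ᶠ-sound i≡e) (sym (==ᶠ-sound j≡e))) i≢j
  ... | inj₁ i≡e | inj₂ j≡f = inj₁ (sym (==ᶠ-sound i≡e) , sym (==ᶠ-sound j≡f))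
  ... | inj₂ i≡f | inj₁ j≡e = inj₂ (sym (==ᶠ-sound j≡e) , sym (==ᶠ-sound i≡f))
  ... | inj₂ i≡f | inj₂ j≡f = contradiction (trans (==ᶠ-sound i≡f) (sym (==ᶠ-sound j≡f))) i≢j

  lineTerm-vanishes : ∀ e f v → ¬ IsPair e f → lineTerm e f v ≡ 0ℤ
  lineTerm-vanishes e f v ¬pair with (i ==ᶠ e ∨ i ==ᶠ f) ∧ (j ==ᶠ e ∨ j ==ᶠ f) in joins
  ... | true  = contradiction (joins-pair e f (subst T (sym joins) _)) ¬pair
  ... | false rewrite ∧-zeroʳ (not (i ==ᶠ j)) = if-eta _

  lineTerm-ij : ∀ v → lineTerm i j v ≡
    (if (toℕ i <ᵇ toℕ j) ∧ incidentᵇ Σ v i ∧ incidentᵇ Σ v j then w v else 0ℤ)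
  lineTerm-ij v rewrite ==ᶠ-refl i | ==ᶠ-refl j | ==ᶠ-≢ i≢j | ==ᶠ-≢ (i≢j ∘ sym) = refl

  lineTerm-ji : ∀ v → lineTerm j i v ≡
    (if (toℕ j <ᵇ toℕ i) ∧ incidentᵇ Σ v j ∧ incidentᵇ Σ v i then w v else 0ℤ)
  lineTerm-ji v rewrite ==ᶠ-refl i | ==ᶠ-refl j | ==ᶠ-≢ i≢j = refl

  pairSum : Fin m → Fin m → ℤ
  pairSum e f = sumOver (allFin n) (lineTerm e f)

  pairSum-vanishes : ∀ e f → ¬ IsPair e f → pairSum e f ≡ 0ℤ
  pairSum-vanishes e f ¬pair = sumOver-zero (allFin n) (λ v → lineTerm-vanishes e f v ¬pair)

  pairs-localise : sumOver (allFin m) (λ e → sumOver (allFin m) (pairSum e)) ≡ pairSum i j + pairSum j i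
  pairs-localise = begin
    sumOver (allFin m) (λ e → sumOver (allFin m) (pairSum e))
      ≡⟨ sumOver-support₂ _ i≢j (λ e e≢i e≢j → sumOver-zero (allFin m) (λ f → pairSum-vanishes e f
           λ { (inj₁ (e≡i , _)) → e≢i e≡i ; (inj₂ (e≡j , _)) → e≢j e≡j })) ⟩
    sumOver (allFin m) (pairSum i) + sumOver (allFin m) (pairSum j)
      ≡⟨ cong₂ _+_
           (sumOver-support₁ _ j (λ f f≢j → pairSum-vanishes i f
              λ { (inj₁ (_ , f≡j)) → f≢j f≡j ; (inj₂ (i≡j , _)) → i≢j i≡j }))
           (sumOver-support₁ _ i (λ f f≢i → pairSum-vanishes j f
              λ { (inj₁ (j≡i , _)) → i≢j (sym j≡i) ; (inj₂ (_ , f≡i)) → f≢i f≡i })) ⟩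
    pairSum i j + pairSum j i ∎
    where open ≡-Reasoning

  -- Exactly one of (i, j), (j, i) is ordered, so the two contributions
  -- together count every common vertex of i and j once.
  pairs-combine : pairSum i j + pairSum j i ≡
    sumOver (allFin n) (λ v → if incidentᵇ Σ v i ∧ incidentᵇ Σ v j then w v else 0ℤ)
  pairs-combine = begin
    pairSum i j + pairSum j i
      ≡⟨ sym (sumOver-+ (allFin n) (lineTerm i j) (lineTerm j i)) ⟩
    sumOver (allFin n) (λ v → lineTerm i j v + lineTerm j i v)
      ≡⟨ sumOver-cong (allFin n) (λ v → cong₂ _+_ (lineTerm-ij v) (lineTerm-ji v)) ⟩
    sumOver (allFin n) (λ v → (if (toℕ i <ᵇ toℕ j) ∧ incidentᵇ Σ v i ∧ incidentᵇ Σ v j then w v else 0ℤ)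
                            + (if (toℕ j <ᵇ toℕ i) ∧ incidentᵇ Σ v j ∧ incidentᵇ Σ v i then w v else 0ℤ))
      ≡⟨ sumOver-cong (allFin n) (λ v → trans
           (cong (λ q → (if (toℕ i <ᵇ toℕ j) ∧ incidentᵇ Σ v i ∧ incidentᵇ Σ v j then w v else 0ℤ)
                      + (if q ∧ incidentᵇ Σ v j ∧ incidentᵇ Σ v i then w v else 0ℤ)) j<i≡not-i<j)
           (guard-by-order (toℕ i <ᵇ toℕ j) (incidentᵇ Σ v i) (incidentᵇ Σ v j) (w v))) ⟩
    sumOver (allFin n) (λ v → if incidentᵇ Σ v i ∧ incidentᵇ Σ v j then w v else 0ℤ) ∎
    where
    open ≡-Reasoning
    j<i≡not-i<j : (toℕ j <ᵇ toℕ i) ≡ not (toℕ i <ᵇ toℕ j)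
    j<i≡not-i<j = <ᵇ-complement (i≢j ∘ sym ∘ toℕ-injective)

  entries-agree : adjMatrix (lineOHG Σ o) i j ≡ adjMatrix (dualOHG Σ o) i j
  entries-agree = begin
    adjMatrix (lineOHG Σ o) i j                                  ≡⟨ line-entry ⟩
    sumOver (allFin m) (λ e → sumOver (allFin m) (pairSum e))    ≡⟨ pairs-localise ⟩
    pairSum i j + pairSum j i                                    ≡⟨ pairs-combine ⟩
    sumOver (allFin n) (λ v → if incidentᵇ Σ v i ∧ incidentᵇ Σ v j then w v else 0ℤ)
                                                                 ≡⟨ sym dual-entry ⟩
    adjMatrix (dualOHG Σ o) i j                                  ∎
    where open ≡-Reasoning

theorem3p4 : {n m : ℕ} (Σ : SimpleSignedGraph n m) (o : Orientation Σ) →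
    (i j : Fin m) →
    adjMatrix (lineOHG Σ o) i j ≡ adjMatrix (dualOHG Σ o) i j
theorem3p4 Σ o i j = by-cases (i ≟ j)
  where
  -- Deciding i ≡ j without abstracting over it (the entries mention i ≟ j).
  by-cases : Dec (i ≡ j) → adjMatrix (lineOHG Σ o) i j ≡ adjMatrix (dualOHG Σ o) i j
  by-cases (yes refl) = trans (adjMatrix-diagonal (lineOHG Σ o) i) (sym (adjMatrix-diagonal (dualOHG Σ o) i))
  by-cases (no  i≢j)  = OffDiagonal.entries-agree Σ o i≢j
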